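{- There exists $\alpha_0>0$ such that for every $\alpha\in(0,\alpha_0]$ there is $\tau_0>0$ such that for every $\tau\in(0,\tau_0]$ there is $\gamma_0>0$ such that for every $\gamma\in(0,\gamma_0]$ there is $n_0$ such that the following holds for all $n\geq n_0$ and $k\in\mathbb{N}$. Let $G$ be a $d$-regular digraph on $n$ vertices with $d\geq \alpha n$, and let $\mathcal{P}_k=\{V_{ij}:i,j\in [k]\}$ be an extremal $(k^2,\tau,\gamma)$-partition of $G$. Then for all $i,j \in [k]$ and $w\in V_{ij}$ we have $d_{V_{*i'}}^{+}(w)\leq d_{V_{*i}}^{+}(w)$ and $d_{V_{j'*}}^{ - }(w)\leq d_{V_{j*}}^{ - }(w)$ for all $i',j'\in[k]$. In particular, $d_{V_{j'*}}^{ - }(w), d_{V_{*i'}}^{+}(w)\leq d/2$ for all $i'\neq i$ and $j'\neq j$, and every vertex $v\in V(G)$ has at least $d/k$ outneighbours and at least $d/k$ inneighbours in the digraph $(V(G),\mathcal{G}_k(\mathcal{P}_k,G))$.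
   Context: A digraph is a finite directed graph without loops, with at most one edge from $a$ to $b$ for each ordered pair of distinct vertices; it is $d$-regular if every vertex has exactly $d$ outneighbours and $d$ inneighbours. For $S\subseteq V(G)$, $d^+_S(v)$ and $d^-_S(v)$ are the numbers of outneighbours and inneighbours of $v$ in $S$. A $k^2$-partition of $V(G)$ is a partition $\{V_{ij}:i,j\in[k]\}$ of $V(G)$ (parts may be empty); write $V_{i*}=\bigcup_{j}V_{ij}$, $V_{*j}=\bigcup_i V_{ij}$. $E(A,B)$ is the set of edges $ab$ with $a\in A$, $b\in B$. Good edges: $\mathcal{G}_k(\mathcal{P}_k,G)=\bigcup_i E(V_{i*},V_{*i})$; bad edges: $\mathcal{B}_k(\mathcal{P}_k,G)=\bigcup_{i\neq j}E(V_{i*},V_{*j})$. A $(k^2,\tau,\gamma)$-partition is a $k^2$-partition with $|\mathcal{B}_k(\mathcal{P}_k,G)|\leq \gamma n^2$ and $|V_{i*}|,|V_{*j}|\geq \tau n$ for all $i,j$. It is extremal if $|\mathcal{B}_k(\mathcal{P}_k,G)|\leq |\mathcal{B}_k(\mathcal{P}'_k,G)|$ for every $(k^2,\tau,\gamma)$-partition $\mathcal{P}_k'$ of $V(G)$.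
   Formalization: The parameters α, τ and γ range over the rationals, and the thresholds α₀, τ₀ and γ₀ are taken in the rationals. -}

module Defs where

open import Data.Nat as ℕ using (ℕ; zero; suc)
open import Data.Integer using (+_)
open import Data.Rational using (ℚ; _/_; _≤_; _*_)
open import Data.Fin using (Fin; zero; suc)
open import Data.Bool using (Bool; true; false; _∧_; not)
open import Data.Product using (_×_; _,_; proj₁; proj₂)
open import Relation.Nullary.Decidable using (⌊_⌋)
open import Data.Fin using (_≟_)
open import Relation.Binary.PropositionalEquality using (_≡_)

ℕtoℚ : ℕ → ℚ
ℕtoℚ n = + n / 1

count : ∀ {n} → (Fin n → Bool) → ℕ
count {zero} p = 0
count {suc n} p with p zero
... | true  = suc (count (λ x → p (suc x)))
... | false = count (λ x → p (suc x))

-- A digraph on vertex set Fin n: adj a b = true iff there is an edge a → b.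
-- At most one edge per ordered pair is automatic; no loops is a field.
record Digraph (n : ℕ) : Set where
  field
    adj      : Fin n → Fin n → Bool
    loopless : ∀ v → adj v v ≡ false
open Digraph public

outdegIn : ∀ {n} → Digraph n → (Fin n → Bool) → Fin n → ℕ
outdegIn G S v = count (λ u → adj G v u ∧ S u)

indegIn : ∀ {n} → Digraph n → (Fin n → Bool) → Fin n → ℕ
indegIn G S v = count (λ u → adj G u v ∧ S u)

all1 : ∀ {n} → Fin n → Bool
all1 _ = true

IsRegular : ∀ {n} → Digraph n → ℕ → Set
IsRegular G d = ∀ v → outdegIn G all1 v ≡ d × indegIn G all1 v ≡ d

-- A k²-partition: vertex v lies in V_{ij} iff P v ≡ (i , j).
Partition : ℕ → ℕ → Set
Partition n k = Fin n → Fin k × Fin k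

eqb : ∀ {k} → Fin k → Fin k → Bool
eqb i j = ⌊ i ≟ j ⌋

inRow : ∀ {n k} → Partition n k → Fin k → Fin n → Bool
inRow P i v = eqb (proj₁ (P v)) i

inCol : ∀ {n k} → Partition n k → Fin k → Fin n → Bool
inCol P j v = eqb (proj₂ (P v)) j

sumFin : ∀ {m} → (Fin m → ℕ) → ℕ
sumFin {zero} f = 0
sumFin {suc m} f = f zero ℕ.+ sumFin (λ x → f (suc x))

badCount : ∀ {n k} → Digraph n → Partition n k → ℕ
badCount G P =
  sumFin (λ a → count (λ b → adj G a b ∧ not (eqb (proj₁ (P a)) (proj₂ (P b)))))

-- good out-/in-neighbours of v in (V(G), G_k(P,G)):
-- u with vu ∈ E(V_{i*},V_{*i}), i.e. row(v) = col(u); u with uv ∈ E, row(u) = col(v)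
goodOut : ∀ {n k} → Digraph n → Partition n k → Fin n → ℕ
goodOut G P v = count (λ u → adj G v u ∧ eqb (proj₁ (P v)) (proj₂ (P u)))

goodIn : ∀ {n k} → Digraph n → Partition n k → Fin n → ℕ
goodIn G P v = count (λ u → adj G u v ∧ eqb (proj₁ (P u)) (proj₂ (P v)))

IsPartitionτγ : ∀ {n k} → Digraph n → ℚ → ℚ → Partition n k → Set
IsPartitionτγ {n} {k} G τ γ P =
  (ℕtoℚ (badCount G P) ≤ γ * ℕtoℚ (n ℕ.* n))
  × (∀ (i : Fin k) → τ * ℕtoℚ n ≤ ℕtoℚ (count (inRow P i)))
  × (∀ (j : Fin k) → τ * ℕtoℚ n ≤ ℕtoℚ (count (inCol P j)))

IsExtremal : ∀ {n k} → Digraph n → ℚ → ℚ → Partition n k → Set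
IsExtremal {n} {k} G τ γ P =
  IsPartitionτγ G τ γ P
  × (∀ (P' : Partition n k) → IsPartitionτγ G τ γ P' → badCount G P ℕ.≤ badCount G P')

-- Every column of a (k²,τ,γ)-partition has more than τn vertices: otherwise each of the
-- at least τn vertices of the matching row sends almost all of its d ≥ αn out-edges to
-- other columns, which gives more than γn² bad edges. Reversing all edges and transposing
-- the partition turns rows into columns, so rows are large as well. Hence a vertex
-- w ∈ V_ij can be moved to V_i'j without violating the size constraints. The move only
-- changes the status of the out-edges of w, so if w had more out-neighbours in V_*i' than
-- in V_*i it would strictly decrease the number of bad edges, contradicting extremality.
-- The remaining bounds follow by splitting d among the columns.
module Submission where

open import Defs
open import Data.Bool using (Bool; true; false; _∧_; not)
open import Data.Fin using (Fin; zero; suc; _≟_)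
open import Data.Product using (Σ; _×_; _,_; proj₁; proj₂; swap)
open import Relation.Binary.PropositionalEquality
open import Relation.Nullary using (yes; no; contradiction)

module Counting where

  open import Data.Fin using (punchIn)
  open import Data.Fin.Properties using (punchInᵢ≢i)
  open import Data.Vec.Functional using (removeAt)
  open import Function using (_∘_)
  open import Data.Nat using (ℕ; zero; suc; _+_; _*_; _≤_; _<_; z≤n)
  open import Data.Nat.Properties hiding (_≟_)
  open import Algebra.Properties.CommutativeSemigroup +-commutativeSemigroup using (x∙yz≈y∙xz)
  open import Algebra.Properties.Semiring.Sum +-*-semiring
    using (sum; sum-cong-≗; sum-remove; sum-replicate-zero; ∑-distrib-+; ∑-comm; *-distribʳ-sum)
    public

  indicator : Bool → ℕ
  indicator true  = 1
  indicator false = 0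

  indicator≤1 : ∀ b → indicator b ≤ 1
  indicator≤1 true  = ≤-refl
  indicator≤1 false = z≤n

  sumFin≡sum : ∀ {m} (f : Fin m → ℕ) → sumFin f ≡ sum f
  sumFin≡sum {zero}  f = refl
  sumFin≡sum {suc m} f = cong (f zero +_) (sumFin≡sum (λ x → f (suc x)))

  count≡sum : ∀ {n} (p : Fin n → Bool) → count p ≡ sum (λ x → indicator (p x))
  count≡sum {zero}  p = refl
  count≡sum {suc n} p with p zero
  ... | true  = cong suc (count≡sum (λ x → p (suc x)))
  ... | false = count≡sum (λ x → p (suc x))

  sum-mono-≤ : ∀ {m} {f g : Fin m → ℕ} → (∀ x → f x ≤ g x) → sum f ≤ sum g
  sum-mono-≤ {zero}  f≤g = z≤n
  sum-mono-≤ {suc m} f≤g = +-mono-≤ (f≤g zero) (sum-mono-≤ (λ x → f≤g (suc x)))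

  sum-≤-* : ∀ {m b} {f : Fin m → ℕ} → (∀ x → f x ≤ b) → sum f ≤ m * b
  sum-≤-* {zero}  f≤b = z≤n
  sum-≤-* {suc m} f≤b = +-mono-≤ (f≤b zero) (sum-≤-* (λ x → f≤b (suc x)))

  sum-cong-except : ∀ {m} {f g : Fin m → ℕ} (w : Fin m) → (∀ x → x ≢ w → f x ≡ g x) →
    g w + sum f ≡ f w + sum g
  sum-cong-except {suc m} {f} {g} w f≗g = begin
    g w + sum f                      ≡⟨ cong (g w +_) (sum-remove {i = w} f) ⟩
    g w + (f w + sum (removeAt f w)) ≡⟨ x∙yz≈y∙xz (g w) (f w) _ ⟩
    f w + (g w + sum (removeAt f w)) ≡⟨ cong (λ s → f w + (g w + s)) (sum-cong-≗ off-w) ⟩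
    f w + (g w + sum (removeAt g w)) ≡⟨ cong (f w +_) (sum-remove {i = w} g) ⟨
    f w + sum g                      ∎
    where
    open ≡-Reasoning
    off-w : ∀ j → f (punchIn w j) ≡ g (punchIn w j)
    off-w j = f≗g (punchIn w j) (punchInᵢ≢i w j)

  sum-indicator-* : ∀ {n} (p : Fin n → Bool) a → sum (λ x → indicator (p x) * a) ≡ count p * a
  sum-indicator-* p a = trans (sym (*-distribʳ-sum a (λ x → indicator (p x)))) (cong (_* a) (sym (count≡sum p)))

  count-cong : ∀ {n} {p q : Fin n → Bool} → (∀ x → p x ≡ q x) → count p ≡ count q
  count-cong {p = p} {q} p≗q =
    trans (count≡sum p) (trans (sum-cong-≗ (λ x → cong indicator (p≗q x))) (sym (count≡sum q)))

  count-mono : ∀ {n} {p q : Fin n → Bool} → (∀ x → p x ≡ true → q x ≡ true) → count p ≤ count q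
  count-mono {p = p} {q} p⇒q = subst₂ _≤_ (sym (count≡sum p)) (sym (count≡sum q)) (sum-mono-≤ pointwise)
    where
    pointwise : ∀ x → indicator (p x) ≤ indicator (q x)
    pointwise x with p x in px
    ... | false = z≤n
    ... | true  rewrite p⇒q x px = ≤-refl

  count-∧-+-∧-not : ∀ {n} (p q : Fin n → Bool) →
    count (λ x → p x ∧ q x) + count (λ x → p x ∧ not (q x)) ≡ count p
  count-∧-+-∧-not p q = begin
    count (λ x → p x ∧ q x) + count (λ x → p x ∧ not (q x))
      ≡⟨ cong₂ _+_ (count≡sum (λ x → p x ∧ q x)) (count≡sum (λ x → p x ∧ not (q x))) ⟩
    sum (λ x → indicator (p x ∧ q x)) + sum (λ x → indicator (p x ∧ not (q x)))
      ≡⟨ ∑-distrib-+ (λ x → indicator (p x ∧ q x)) (λ x → indicator (p x ∧ not (q x))) ⟨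
    sum (λ x → indicator (p x ∧ q x) + indicator (p x ∧ not (q x)))
      ≡⟨ sum-cong-≗ pointwise ⟩
    sum (λ x → indicator (p x))
      ≡⟨ count≡sum p ⟨
    count p ∎
    where
    open ≡-Reasoning
    pointwise : ∀ x → indicator (p x ∧ q x) + indicator (p x ∧ not (q x)) ≡ indicator (p x)
    pointwise x with p x | q x
    ... | false | _     = refl
    ... | true  | true  = refl
    ... | true  | false = refl

  count-cong-except-≤-+1 : ∀ {n} {p q : Fin n → Bool} (w : Fin n) → (∀ x → x ≢ w → p x ≡ q x) →
    count p ≤ count q + 1
  count-cong-except-≤-+1 {p = p} {q} w p≗q = begin
    count p                      ≤⟨ m≤n+m (count p) (indicator (q w)) ⟩
    indicator (q w) + count p    ≡⟨ cong₂ _+_ refl (count≡sum p) ⟩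
    indicator (q w) + sum (λ x → indicator (p x))
      ≡⟨ sum-cong-except w (λ x x≢w → cong indicator (p≗q x x≢w)) ⟩
    indicator (p w) + sum (λ x → indicator (q x))
      ≡⟨ cong₂ _+_ refl (count≡sum q) ⟨
    indicator (p w) + count q    ≤⟨ +-monoˡ-≤ (count q) (indicator≤1 (p w)) ⟩
    1 + count q                  ≡⟨ +-comm 1 (count q) ⟩
    count q + 1                  ∎
    where open ≤-Reasoning

  eqb-refl : ∀ {k} (i : Fin k) → eqb i i ≡ true
  eqb-refl i with i ≟ i
  ... | yes _   = refl
  ... | no i≢i = contradiction refl i≢i

  ≢⇒eqb≡false : ∀ {k} {i j : Fin k} → i ≢ j → eqb i j ≡ false
  ≢⇒eqb≡false {i = i} {j} i≢j with i ≟ j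
  ... | yes i≡j = contradiction i≡j i≢j
  ... | no _    = refl

  eqb≡true⇒≡ : ∀ {k} {i j : Fin k} → eqb i j ≡ true → i ≡ j
  eqb≡true⇒≡ {i = i} {j} eq with i ≟ j
  ... | yes i≡j = i≡j

  eqb-sym : ∀ {k} (i j : Fin k) → eqb i j ≡ eqb j i
  eqb-sym i j with i ≟ j
  ... | yes refl = sym (eqb-refl i)
  ... | no i≢j   = sym (≢⇒eqb≡false (i≢j ∘ sym))

  sum-indicator-eqb : ∀ {k} (i : Fin k) → sum (λ j → indicator (eqb i j)) ≡ 1
  sum-indicator-eqb {suc k} i = begin
    sum (λ j → indicator (eqb i j))
      ≡⟨ sum-remove {i = i} (λ j → indicator (eqb i j)) ⟩
    indicator (eqb i i) + sum (λ j → indicator (eqb i (punchIn i j)))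
      ≡⟨ cong₂ _+_ (cong indicator (eqb-refl i)) (sum-cong-≗ off-i) ⟩
    1 + sum {k} (λ _ → 0)
      ≡⟨ cong (1 +_) (sum-replicate-zero k) ⟩
    1 ∎
    where
    open ≡-Reasoning
    off-i : ∀ j → indicator (eqb i (punchIn i j)) ≡ 0
    off-i j = cong indicator (≢⇒eqb≡false (punchInᵢ≢i i j ∘ sym))

  count-by-colour : ∀ {n k} (p : Fin n → Bool) (colour : Fin n → Fin k) →
    count p ≡ sum (λ c → count (λ x → p x ∧ eqb (colour x) c))
  count-by-colour {k = k} p colour = begin
    count p
      ≡⟨ count≡sum p ⟩
    sum (λ x → indicator (p x))
      ≡⟨ sum-cong-≗ split ⟩
    sum (λ x → sum (λ c → indicator (p x ∧ eqb (colour x) c)))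
      ≡⟨ ∑-comm (λ x c → indicator (p x ∧ eqb (colour x) c)) ⟩
    sum (λ c → sum (λ x → indicator (p x ∧ eqb (colour x) c)))
      ≡⟨ sum-cong-≗ (λ c → count≡sum (λ x → p x ∧ eqb (colour x) c)) ⟨
    sum (λ c → count (λ x → p x ∧ eqb (colour x) c)) ∎
    where
    open ≡-Reasoning
    split : ∀ x → indicator (p x) ≡ sum (λ c → indicator (p x ∧ eqb (colour x) c))
    split x with p x
    ... | true  = sym (sum-indicator-eqb (colour x))
    ... | false = sym (sum-replicate-zero k)

  m+n≡o+p⇒m<o⇒p<n : ∀ {m n o p} → m + n ≡ o + p → m < o → p < n
  m+n≡o+p⇒m<o⇒p<n {m} {n} {o} {p} m+n≡o+p m<o =
    +-cancelˡ-< m p n (subst (m + p <_) (sym m+n≡o+p) (+-monoˡ-< p m<o))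

module RationalBounds where

  open import Data.Nat as ℕ using (ℕ; suc)
  import Data.Nat.Properties as ℕ
  open import Data.Nat.Coprimality using (1-coprimeTo)
  import Data.Nat.Coprimality as Coprime
  open import Data.Integer as ℤ using (+_; +[1+_]; +≤+)
  import Data.Integer.Properties as ℤ
  open import Data.Rational
  open import Data.Rational.Properties
  import Data.Rational.Unnormalised as ℚᵘ
  import Data.Rational.Unnormalised.Properties as ℚᵘ
  open import Data.Rational.Solver using (module +-*-Solver)
  open import Data.Empty using (⊥)
  open +-*-Solver

  ¼ : ℚ
  ¼ = + 1 / 4

  -- `+ n / 1` is normalised through a gcd, so it is not definitionally this literal fraction.
  ℕtoℚ≡mkℚ : ∀ n → ℕtoℚ n ≡ mkℚ (+ n) 0 (Coprime.sym (1-coprimeTo n))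
  ℕtoℚ≡mkℚ n = ↥p/↧p≡p (mkℚ (+ n) 0 (Coprime.sym (1-coprimeTo n)))

  ℕtoℚ-+ : ∀ a b → ℕtoℚ (a ℕ.+ b) ≡ ℕtoℚ a + ℕtoℚ b
  ℕtoℚ-+ a b rewrite ℕtoℚ≡mkℚ a | ℕtoℚ≡mkℚ b =
    cong (_/ 1) (trans (ℤ.pos-+ a b) (sym (cong₂ ℤ._+_ (ℤ.*-identityʳ (+ a)) (ℤ.*-identityʳ (+ b)))))

  ℕtoℚ-* : ∀ a b → ℕtoℚ (a ℕ.* b) ≡ ℕtoℚ a * ℕtoℚ b
  ℕtoℚ-* a b rewrite ℕtoℚ≡mkℚ a | ℕtoℚ≡mkℚ b = cong (_/ 1) (ℤ.pos-* a b)

  ℕtoℚ-mono-≤ : ∀ {a b} → a ℕ.≤ b → ℕtoℚ a ≤ ℕtoℚ b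
  ℕtoℚ-mono-≤ {a} {b} a≤b rewrite ℕtoℚ≡mkℚ a | ℕtoℚ≡mkℚ b =
    *≤* (subst₂ ℤ._≤_ (sym (ℤ.*-identityʳ (+ a))) (sym (ℤ.*-identityʳ (+ b))) (+≤+ a≤b))

  ℕtoℚ-nonNeg : ∀ n → NonNegative (ℕtoℚ n)
  ℕtoℚ-nonNeg n = nonNegative (ℕtoℚ-mono-≤ {0} {n} ℕ.z≤n)

  0<1 : 0ℚ < 1ℚ
  0<1 = positive⁻¹ 1ℚ

  *-pos : ∀ {p q} → 0ℚ < p → 0ℚ < q → 0ℚ < p * q
  *-pos {p} {q} 0<p 0<q = positive⁻¹ (p * q) {{pos*pos⇒pos p {{positive 0<p}} q {{positive 0<q}}}}

  +-cancelʳ-≤ : ∀ r {p q} → p + r ≤ q + r → p ≤ q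
  +-cancelʳ-≤ r p+r≤q+r = ≮⇒≥ (λ q<p → <-irrefl refl (<-≤-trans (+-monoˡ-< r q<p) p+r≤q+r))

  -- α = (m+1)/(d+1), so α · (d+1) = m+1.
  1≤α*↧α : ∀ α → 0ℚ < α → 1ℚ ≤ α * ℕtoℚ (↧ₙ α)
  1≤α*↧α (mkℚ (+ 0) d c) (*<* (ℤ.+<+ ()))
  1≤α*↧α (mkℚ ℤ.-[1+ m ] d c) (*<* ())
  1≤α*↧α (mkℚ +[1+ m ] d c) 0<α rewrite ℕtoℚ≡mkℚ (suc d) =
    toℚᵘ-cancel-≤ (ℚᵘ.≤-respʳ-≃ (ℚᵘ.≃-sym (toℚᵘ-fromℚᵘ (ℚᵘ.mkℚᵘ (+[1+ m ] ℤ.* + suc d) (d ℕ.* 1))))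
      (ℚᵘ.*≤* (subst₂ ℤ._≤_ (sym (ℤ.*-identityˡ (+ suc (d ℕ.* 1))))
         (trans (ℤ.pos-* (suc m) (suc d)) (sym (ℤ.*-identityʳ _)))
         (+≤+ (ℕ.≤-trans (ℕ.s≤s (ℕ.≤-reflexive (ℕ.*-identityʳ d))) (ℕ.m≤n*m (suc d) (suc m)))))))

  1≤¼*α*n : ∀ {α n} → 0ℚ < α → 4 ℕ.* ↧ₙ α ℕ.≤ n → 1ℚ ≤ ¼ * (α * ℕtoℚ n)
  1≤¼*α*n {α} {n} 0<α n≥ = begin
    1ℚ
      ≤⟨ 1≤α*↧α α 0<α ⟩
    α * ℕtoℚ (↧ₙ α)
      ≡⟨ quarter-of-four ⟨
    ¼ * (α * ℕtoℚ (4 ℕ.* ↧ₙ α))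
      ≤⟨ *-monoˡ-≤-nonNeg ¼ (*-monoˡ-≤-nonNeg α {{αnonNeg}} (ℕtoℚ-mono-≤ n≥)) ⟩
    ¼ * (α * ℕtoℚ n) ∎
    where
    open ≤-Reasoning
    αnonNeg : NonNegative α
    αnonNeg = pos⇒nonNeg α {{positive 0<α}}
    quarter-of-four : ¼ * (α * ℕtoℚ (4 ℕ.* ↧ₙ α)) ≡ α * ℕtoℚ (↧ₙ α)
    quarter-of-four = begin-equality
      ¼ * (α * ℕtoℚ (4 ℕ.* ↧ₙ α))       ≡⟨ cong (λ x → ¼ * (α * x)) (ℕtoℚ-* 4 (↧ₙ α)) ⟩
      ¼ * (α * (ℕtoℚ 4 * ℕtoℚ (↧ₙ α)))
        ≡⟨ solve 4 (λ q a f e → q :* (a :* (f :* e)) := (q :* f) :* (a :* e)) refl ¼ α (ℕtoℚ 4) (ℕtoℚ (↧ₙ α)) ⟩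
      (¼ * ℕtoℚ 4) * (α * ℕtoℚ (↧ₙ α))  ≡⟨ *-identityˡ (α * ℕtoℚ (↧ₙ α)) ⟩
      α * ℕtoℚ (↧ₙ α)                   ∎

  record Admissible (α τ γ : ℚ) (n : ℕ) : Set where
    field
      0<τn   : 0ℚ < τ * ℕtoℚ n
      τ≤α/4  : τ ≤ ¼ * α
      γ≤ατ/4 : γ ≤ ¼ * (α * τ)
      4≤αn   : 1ℚ ≤ ¼ * (α * ℕtoℚ n)

  -- R, C, D and b stand for the sizes of a row and of the matching column, the degree and the
  -- number of bad edges; a column of size at most τn would force R(D − C) > γn² bad edges.
  thickness-bound : ∀ {α τ γ n} {R C D b : ℚ} → Admissible α τ γ n →
    τ * ℕtoℚ n ≤ R → α * ℕtoℚ n ≤ D → b ≤ γ * (ℕtoℚ n * ℕtoℚ n) → R * D ≤ R * C + b →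
    τ * ℕtoℚ n + 1ℚ ≤ C
  thickness-bound {α} {τ} {γ} {n} {R} {C} {D} {b} adm T≤R A≤D b≤γN² RD≤RC+b = ≮⇒≥ thin-impossible
    where
    open Admissible adm
    open ≤-Reasoning
    N = ℕtoℚ n
    T = τ * N
    h = ¼ * (α * N)
    instance
      _ : NonNegative N
      _ = ℕtoℚ-nonNeg n
      _ : Positive R
      _ = positive (<-≤-trans 0<τn T≤R)
      _ : NonNegative R
      _ = pos⇒nonNeg R
      _ : NonNegative h
      _ = nonNegative (≤-trans (<⇒≤ 0<1) 4≤αn)
      _ : NonNegative (N * N)
      _ = nonNeg*nonNeg⇒nonNeg N N
    T≤h : T ≤ h
    T≤h = begin
      τ * N       ≤⟨ *-monoʳ-≤-nonNeg N τ≤α/4 ⟩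
      ¼ * α * N   ≡⟨ *-assoc ¼ α N ⟩
      h           ∎
    four-h : (h + h) + (h + h) ≡ α * N
    four-h = trans
      (solve 2 (λ q a → (q :* a :+ q :* a) :+ (q :* a :+ q :* a) := (q :+ q :+ q :+ q) :* a) refl ¼ (α * N))
      (*-identityˡ (α * N))
    b≤R*[h+h] : b ≤ R * (h + h)
    b≤R*[h+h] = begin
      b                       ≤⟨ b≤γN² ⟩
      γ * (N * N)             ≤⟨ *-monoʳ-≤-nonNeg (N * N) γ≤ατ/4 ⟩
      ¼ * (α * τ) * (N * N)
        ≡⟨ solve 4 (λ q a t m → q :* (a :* t) :* (m :* m) := (t :* m) :* (q :* (a :* m))) refl ¼ α τ N ⟩
      T * h                   ≤⟨ *-monoʳ-≤-nonNeg h T≤R ⟩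
      R * h                   ≡⟨ cong (R *_) (+-identityʳ h) ⟨
      R * (h + 0ℚ)            ≤⟨ *-monoˡ-≤-nonNeg R (+-monoʳ-≤ h (nonNegative⁻¹ h)) ⟩
      R * (h + h)             ∎
    thin-impossible : C < T + 1ℚ → ⊥
    thin-impossible C<T+1 = <-irrefl refl (begin-strict
      R * C + R * (h + h)     ≡⟨ *-distribˡ-+ R C (h + h) ⟨
      R * (C + (h + h))       <⟨ *-monoʳ-<-pos R (+-monoˡ-< (h + h) C<h+h) ⟩
      R * ((h + h) + (h + h)) ≡⟨ cong (R *_) four-h ⟩
      R * (α * N)             ≤⟨ *-monoˡ-≤-nonNeg R A≤D ⟩
      R * D                   ≤⟨ RD≤RC+b ⟩
      R * C + b               ≤⟨ +-monoʳ-≤ (R * C) b≤R*[h+h] ⟩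
      R * C + R * (h + h)     ∎)
      where
      C<h+h : C < h + h
      C<h+h = <-≤-trans C<T+1 (+-mono-≤ T≤h 4≤αn)

  ¼*-pos : ∀ {p} → 0ℚ < p → 0ℚ < ¼ * p
  ¼*-pos = *-pos (positive⁻¹ ¼)

  admissible : ∀ {α τ γ n} → 0ℚ < α → 0ℚ < τ → τ ≤ ¼ * α → γ ≤ ¼ * (α * τ) →
    4 ℕ.* ↧ₙ α ℕ.≤ n → Admissible α τ γ n
  admissible 0<α 0<τ τ≤α/4 γ≤ατ/4 n≥ = record
    { 0<τn   = *-pos 0<τ (<-≤-trans 0<1 (ℕtoℚ-mono-≤ (ℕ.≤-trans (ℕ.s≤s ℕ.z≤n) n≥)))
    ; τ≤α/4  = τ≤α/4
    ; γ≤ατ/4 = γ≤ατ/4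
    ; 4≤αn   = 1≤¼*α*n 0<α n≥
    }

module Digraphs where

  open import Data.Nat using (ℕ; _+_; _*_; _≤_; _<_; z≤n)
  open import Data.Nat.Properties
    using (<⇒≤; <⇒≱; ≮⇒≥; +-identityʳ; *-identityˡ; +-mono-≤; +-monoˡ-≤; module ≤-Reasoning)
  open import Data.Bool using (if_then_else_)
  open import Data.Bool.Properties using (∧-identityʳ; ∧-conicalʳ)
  open import Data.Rational as ℚ using (ℚ; 1ℚ)
  import Data.Rational.Properties as ℚₚ
  open import Relation.Nullary.Decidable using (⌊_⌋)
  open Counting
  open RationalBounds using (ℕtoℚ-+; ℕtoℚ-*; ℕtoℚ-mono-≤; +-cancelʳ-≤; Admissible; thickness-bound)

  reverse : ∀ {n} → Digraph n → Digraph n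
  reverse G = record { adj = λ a b → adj G b a ; loopless = loopless G }

  transpose : ∀ {n k} → Partition n k → Partition n k
  transpose P v = swap (P v)

  badOut : ∀ {n k} → Digraph n → Partition n k → Fin n → ℕ
  badOut G P a = count (λ b → adj G a b ∧ not (eqb (proj₁ (P a)) (proj₂ (P b))))

  OwnColumnMaximal : ∀ {n k} → Digraph n → Partition n k → Set
  OwnColumnMaximal G P = ∀ w r → outdegIn G (inCol P r) w ≤ outdegIn G (inCol P (proj₁ (P w))) w

  moveRow : ∀ {n k} → Partition n k → Fin n → Fin k → Partition n k
  moveRow P w r v = (if ⌊ v ≟ w ⌋ then r else proj₁ (P v)) , proj₂ (P v)

  outdeg≡d : ∀ {n d} (G : Digraph n) → IsRegular G d → ∀ v → count (adj G v) ≡ d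
  outdeg≡d G regular v = trans (count-cong (λ u → sym (∧-identityʳ (adj G v u)))) (proj₁ (regular v))

  outdegIn-≤-count : ∀ {n} (G : Digraph n) S v → outdegIn G S v ≤ count S
  outdegIn-≤-count G S v = count-mono (λ u → ∧-conicalʳ (adj G v u) (S u))

  goodOut≡outdegIn-ownColumn : ∀ {n k} (G : Digraph n) (P : Partition n k) v →
    goodOut G P v ≡ outdegIn G (inCol P (proj₁ (P v))) v
  goodOut≡outdegIn-ownColumn G P v =
    count-cong (λ u → cong (adj G v u ∧_) (eqb-sym (proj₁ (P v)) (proj₂ (P u))))

  outdegIn-ownColumn-+-badOut : ∀ {n k d} (G : Digraph n) (P : Partition n k) → IsRegular G d → ∀ v →
    outdegIn G (inCol P (proj₁ (P v))) v + badOut G P v ≡ d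
  outdegIn-ownColumn-+-badOut G P regular v = begin
    outdegIn G (inCol P (proj₁ (P v))) v + badOut G P v
      ≡⟨ cong (_+ badOut G P v) (goodOut≡outdegIn-ownColumn G P v) ⟨
    goodOut G P v + badOut G P v
      ≡⟨ count-∧-+-∧-not (adj G v) (λ u → eqb (proj₁ (P v)) (proj₂ (P u))) ⟩
    count (adj G v)
      ≡⟨ outdeg≡d G regular v ⟩
    _ ∎
    where open ≡-Reasoning

  row*d≤row*column+bad : ∀ {n k d} (G : Digraph n) (P : Partition n k) → IsRegular G d → ∀ c →
    count (inRow P c) * d ≤ count (inRow P c) * count (inCol P c) + badCount G P
  row*d≤row*column+bad {d = d} G P regular c = begin
    count (inRow P c) * d
      ≡⟨ sum-indicator-* (inRow P c) d ⟨
    sum (λ a → indicator (inRow P c a) * d)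
      ≤⟨ sum-mono-≤ pointwise ⟩
    sum (λ a → indicator (inRow P c a) * C + badOut G P a)
      ≡⟨ ∑-distrib-+ (λ a → indicator (inRow P c a) * C) (badOut G P) ⟩
    sum (λ a → indicator (inRow P c a) * C) + sum (badOut G P)
      ≡⟨ cong₂ _+_ (sum-indicator-* (inRow P c) C) (sym (sumFin≡sum (badOut G P))) ⟩
    count (inRow P c) * C + badCount G P ∎
    where
    open ≤-Reasoning
    C = count (inCol P c)
    pointwise : ∀ a → indicator (inRow P c a) * d ≤ indicator (inRow P c a) * C + badOut G P a
    pointwise a with inRow P c a in a∈row
    ... | false = z≤n
    ... | true  = begin
      1 * d
        ≡⟨ *-identityˡ d ⟩
      d
        ≡⟨ outdegIn-ownColumn-+-badOut G P regular a ⟨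
      outdegIn G (inCol P (proj₁ (P a))) a + badOut G P a
        ≤⟨ +-monoˡ-≤ _ (outdegIn-≤-count G (inCol P (proj₁ (P a))) a) ⟩
      count (inCol P (proj₁ (P a))) + badOut G P a
        ≡⟨ cong (λ r → count (inCol P r) + badOut G P a) (eqb≡true⇒≡ a∈row) ⟩
      C + badOut G P a
        ≡⟨ cong (_+ badOut G P a) (*-identityˡ C) ⟨
      1 * C + badOut G P a ∎

  outdegIn-otherColumn-≤-badOut : ∀ {n k} (G : Digraph n) (P : Partition n k) w r →
    r ≢ proj₁ (P w) → outdegIn G (inCol P r) w ≤ badOut G P w
  outdegIn-otherColumn-≤-badOut G P w r r≢own = count-mono pointwise
    where
    pointwise : ∀ u → adj G w u ∧ inCol P r u ≡ true →
      adj G w u ∧ not (eqb (proj₁ (P w)) (proj₂ (P u))) ≡ true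
    pointwise u with adj G w u | inCol P r u in u∈r
    ... | true | true = λ _ →
      cong not (≢⇒eqb≡false λ own≡col → r≢own (trans (sym (eqb≡true⇒≡ u∈r)) (sym own≡col)))

  twice-outdegIn-otherColumn-≤ : ∀ {n k d} (G : Digraph n) (P : Partition n k) →
    IsRegular G d → OwnColumnMaximal G P → ∀ w r → r ≢ proj₁ (P w) → 2 * outdegIn G (inCol P r) w ≤ d
  twice-outdegIn-otherColumn-≤ G P regular maximal w r r≢own = begin
    2 * outdegIn G (inCol P r) w
      ≡⟨ cong (outdegIn G (inCol P r) w +_) (+-identityʳ _) ⟩
    outdegIn G (inCol P r) w + outdegIn G (inCol P r) w
      ≤⟨ +-mono-≤ (maximal w r) (outdegIn-otherColumn-≤-badOut G P w r r≢own) ⟩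
    outdegIn G (inCol P (proj₁ (P w))) w + badOut G P w
      ≡⟨ outdegIn-ownColumn-+-badOut G P regular w ⟩
    _ ∎
    where open ≤-Reasoning

  d≤k*outdegIn-ownColumn : ∀ {n k d} (G : Digraph n) (P : Partition n k) →
    IsRegular G d → OwnColumnMaximal G P → ∀ v → d ≤ k * outdegIn G (inCol P (proj₁ (P v))) v
  d≤k*outdegIn-ownColumn {k = k} G P regular maximal v = begin
    _                                         ≡⟨ outdeg≡d G regular v ⟨
    count (adj G v)                           ≡⟨ count-by-colour (adj G v) (λ u → proj₂ (P u)) ⟩
    sum (λ c → outdegIn G (inCol P c) v)      ≤⟨ sum-≤-* (maximal v) ⟩
    k * outdegIn G (inCol P (proj₁ (P v))) v  ∎
    where open ≤-Reasoning

  reverse-regular : ∀ {n d} (G : Digraph n) → IsRegular G d → IsRegular (reverse G) d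
  reverse-regular G regular v = swap (regular v)

  badCount-reverse-transpose : ∀ {n k} (G : Digraph n) (P : Partition n k) →
    badCount (reverse G) (transpose P) ≡ badCount G P
  badCount-reverse-transpose G P = begin
    badCount (reverse G) (transpose P)
      ≡⟨ sumFin≡sum (λ a → count (λ b → adj G b a ∧ not (eqb (proj₂ (P a)) (proj₁ (P b))))) ⟩
    sum (λ a → count (λ b → adj G b a ∧ not (eqb (proj₂ (P a)) (proj₁ (P b)))))
      ≡⟨ sum-cong-≗ (λ a → count≡sum (λ b → adj G b a ∧ not (eqb (proj₂ (P a)) (proj₁ (P b))))) ⟩
    sum (λ a → sum (λ b → indicator (adj G b a ∧ not (eqb (proj₂ (P a)) (proj₁ (P b))))))
      ≡⟨ ∑-comm (λ a b → indicator (adj G b a ∧ not (eqb (proj₂ (P a)) (proj₁ (P b))))) ⟩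
    sum (λ b → sum (λ a → indicator (adj G b a ∧ not (eqb (proj₂ (P a)) (proj₁ (P b))))))
      ≡⟨ sum-cong-≗ (λ b → sum-cong-≗ (λ a →
           cong (λ x → indicator (adj G b a ∧ not x)) (eqb-sym (proj₂ (P a)) (proj₁ (P b))))) ⟩
    sum (λ b → sum (λ a → indicator (adj G b a ∧ not (eqb (proj₁ (P b)) (proj₂ (P a))))))
      ≡⟨ sum-cong-≗ (λ b → count≡sum (λ a → adj G b a ∧ not (eqb (proj₁ (P b)) (proj₂ (P a))))) ⟨
    sum (badOut G P)
      ≡⟨ sumFin≡sum (badOut G P) ⟨
    badCount G P ∎
    where open ≡-Reasoning

  moveRow-self : ∀ {n k} (P : Partition n k) w r → proj₁ (moveRow P w r w) ≡ r
  moveRow-self P w r with w ≟ w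
  ... | yes _   = refl
  ... | no w≢w = contradiction refl w≢w

  moveRow-other : ∀ {n k} (P : Partition n k) {w} r {v} → v ≢ w → moveRow P w r v ≡ P v
  moveRow-other P {w} r {v} v≢w with v ≟ w
  ... | yes v≡w = contradiction v≡w v≢w
  ... | no _    = refl

  badCount-moveRow : ∀ {n k} (G : Digraph n) (P : Partition n k) w r →
    badOut G P w + badCount G (moveRow P w r) ≡ badOut G (moveRow P w r) w + badCount G P
  badCount-moveRow G P w r = begin
    badOut G P w + badCount G P′               ≡⟨ cong (badOut G P w +_) (sumFin≡sum (badOut G P′)) ⟩
    badOut G P w + sum (badOut G P′)           ≡⟨ sum-cong-except w unchanged ⟩
    badOut G P′ w + sum (badOut G P)           ≡⟨ cong (badOut G P′ w +_) (sumFin≡sum (badOut G P)) ⟨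
    badOut G P′ w + badCount G P               ∎
    where
    open ≡-Reasoning
    P′ = moveRow P w r
    unchanged : ∀ v → v ≢ w → badOut G P′ v ≡ badOut G P v
    unchanged v v≢w = count-cong (λ b →
      cong (λ x → adj G v b ∧ not (eqb (proj₁ x) (proj₂ (P b)))) (moveRow-other P r v≢w))

  badCount-moveRow-< : ∀ {n k d} (G : Digraph n) (P : Partition n k) → IsRegular G d → ∀ w r →
    outdegIn G (inCol P (proj₁ (P w))) w < outdegIn G (inCol P r) w →
    badCount G (moveRow P w r) < badCount G P
  badCount-moveRow-< G P regular w r own<r =
    m+n≡o+p⇒m<o⇒p<n (sym (badCount-moveRow G P w r)) (m+n≡o+p⇒m<o⇒p<n both-d own<r)
    where
    moved : outdegIn G (inCol P r) w + badOut G (moveRow P w r) w ≡ _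
    moved = subst (λ r′ → outdegIn G (inCol P r′) w + badOut G (moveRow P w r) w ≡ _) (moveRow-self P w r)
              (outdegIn-ownColumn-+-badOut G (moveRow P w r) regular w)
    both-d : outdegIn G (inCol P (proj₁ (P w))) w + badOut G P w ≡ outdegIn G (inCol P r) w + badOut G (moveRow P w r) w
    both-d = trans (outdegIn-ownColumn-+-badOut G P regular w) (sym moved)

  module _ (τ γ : ℚ) where

    thick-columns : ∀ {n k d α} (G : Digraph n) (P : Partition n k) →
      Admissible α τ γ n → IsRegular G d → α ℚ.* ℕtoℚ n ℚ.≤ ℕtoℚ d →
      IsPartitionτγ G τ γ P → ∀ c → τ ℚ.* ℕtoℚ n ℚ.+ 1ℚ ℚ.≤ ℕtoℚ (count (inCol P c))
    thick-columns {n} {d = d} G P adm regular αn≤d (few-bad , thick-rows , _) c =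
      thickness-bound adm (thick-rows c) αn≤d few-bad′
        (subst₂ ℚ._≤_ (ℕtoℚ-* R d) ℕtoℚ-RC+b (ℕtoℚ-mono-≤ (row*d≤row*column+bad G P regular c)))
      where
      R = count (inRow P c)
      C = count (inCol P c)
      few-bad′ : ℕtoℚ (badCount G P) ℚ.≤ γ ℚ.* (ℕtoℚ n ℚ.* ℕtoℚ n)
      few-bad′ = subst (λ x → ℕtoℚ (badCount G P) ℚ.≤ γ ℚ.* x) (ℕtoℚ-* n n) few-bad
      ℕtoℚ-RC+b : ℕtoℚ (R * C + badCount G P) ≡ ℕtoℚ R ℚ.* ℕtoℚ C ℚ.+ ℕtoℚ (badCount G P)
      ℕtoℚ-RC+b = trans (ℕtoℚ-+ (R * C) (badCount G P)) (cong (ℚ._+ ℕtoℚ (badCount G P)) (ℕtoℚ-* R C))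

    transpose-isPartition : ∀ {n k} (G : Digraph n) (P : Partition n k) →
      IsPartitionτγ G τ γ P → IsPartitionτγ (reverse G) τ γ (transpose P)
    transpose-isPartition G P (few-bad , thick-rows , thick-cols) =
      subst (λ b → ℕtoℚ b ℚ.≤ _) (sym (badCount-reverse-transpose G P)) few-bad , thick-cols , thick-rows

    -- `reverse` and `transpose` are involutions definitionally (by η), so minimality transfers.
    transpose-isExtremal : ∀ {n k} (G : Digraph n) (P : Partition n k) →
      IsExtremal G τ γ P → IsExtremal (reverse G) τ γ (transpose P)
    transpose-isExtremal G P (valid , minimal) = transpose-isPartition G P valid , λ P′ valid′ →
      subst₂ _≤_ (sym (badCount-reverse-transpose G P)) (badCount-reverse-transpose (reverse G) P′)
        (minimal (transpose P′) (transpose-isPartition (reverse G) P′ valid′))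

    moveRow-isPartition : ∀ {n k} (G : Digraph n) (P : Partition n k) w r →
      (∀ c → τ ℚ.* ℕtoℚ n ℚ.+ 1ℚ ℚ.≤ ℕtoℚ (count (inRow P c))) → IsPartitionτγ G τ γ P →
      badCount G (moveRow P w r) ≤ badCount G P → IsPartitionτγ G τ γ (moveRow P w r)
    moveRow-isPartition G P w r thick-rows (few-bad , _ , thick-cols) fewer =
      ℚₚ.≤-trans (ℕtoℚ-mono-≤ fewer) few-bad , thick-rows′ , thick-cols
      where
      thick-rows′ : ∀ c → _ ℚ.≤ ℕtoℚ (count (inRow (moveRow P w r) c))
      thick-rows′ c = +-cancelʳ-≤ 1ℚ (ℚₚ.≤-trans (thick-rows c)
        (subst (ℕtoℚ (count (inRow P c)) ℚ.≤_) (ℕtoℚ-+ (count (inRow (moveRow P w r) c)) 1)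
          (ℕtoℚ-mono-≤ (count-cong-except-≤-+1 w same-row))))
        where
        same-row : ∀ x → x ≢ w → inRow P c x ≡ inRow (moveRow P w r) c x
        same-row x x≢w = cong (λ z → eqb (proj₁ z) c) (sym (moveRow-other P r x≢w))

    extremal⇒ownColumnMaximal : ∀ {n k d} (G : Digraph n) (P : Partition n k) →
      IsRegular G d → IsExtremal G τ γ P →
      (∀ c → τ ℚ.* ℕtoℚ n ℚ.+ 1ℚ ℚ.≤ ℕtoℚ (count (inRow P c))) → OwnColumnMaximal G P
    extremal⇒ownColumnMaximal G P regular (valid , minimal) thick-rows w r = ≮⇒≥ λ own<r →
      let fewer = badCount-moveRow-< G P regular w r own<r
      in <⇒≱ fewer (minimal (moveRow P w r) (moveRow-isPartition G P w r thick-rows valid (<⇒≤ fewer)))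

    extremal-degree-bounds : ∀ {α n k d} (G : Digraph n) → Admissible α τ γ n →
      IsRegular G d → α ℚ.* ℕtoℚ n ℚ.≤ ℕtoℚ d →
      ∀ (P : Partition n k) → IsExtremal G τ γ P →
      (∀ (i j : Fin k) (w : Fin n) → P w ≡ (i , j) →
        (∀ (i' : Fin k) → outdegIn G (inCol P i') w ≤ outdegIn G (inCol P i) w)
        × (∀ (j' : Fin k) → indegIn G (inRow P j') w ≤ indegIn G (inRow P j) w)
        × (∀ (i' : Fin k) → i' ≢ i → 2 * outdegIn G (inCol P i') w ≤ d)
        × (∀ (j' : Fin k) → j' ≢ j → 2 * indegIn G (inRow P j') w ≤ d))
      × (∀ (v : Fin n) → d ≤ k * goodOut G P v × d ≤ k * goodIn G P v)
    extremal-degree-bounds {k = k} {d} G adm regular αn≤d P extremal@(valid , _) =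
      (λ { _ _ w refl →
        out-maximal w , in-maximal w ,
        twice-outdegIn-otherColumn-≤ G P regular out-maximal w ,
        twice-outdegIn-otherColumn-≤ Gᵀ Pᵀ regularᵀ in-maximal w }) ,
      λ v → subst (λ x → d ≤ k * x) (sym (goodOut≡outdegIn-ownColumn G P v))
              (d≤k*outdegIn-ownColumn G P regular out-maximal v) ,
            d≤k*outdegIn-ownColumn Gᵀ Pᵀ regularᵀ in-maximal v
      where
      Gᵀ = reverse G
      Pᵀ = transpose P
      regularᵀ = reverse-regular G regular
      out-maximal : OwnColumnMaximal G P
      out-maximal = extremal⇒ownColumnMaximal G P regular extremal
        (thick-columns Gᵀ Pᵀ adm regularᵀ αn≤d (transpose-isPartition G P valid))
      in-maximal : OwnColumnMaximal Gᵀ Pᵀ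
      in-maximal = extremal⇒ownColumnMaximal Gᵀ Pᵀ regularᵀ (transpose-isExtremal G P extremal)
        (thick-columns G P adm regular αn≤d valid)

open import Data.Nat as ℕ using (ℕ)
open import Data.Rational using (ℚ; 0ℚ; 1ℚ; _<_; _≤_; _*_; ↧ₙ_)
open RationalBounds using (¼; 0<1; *-pos; ¼*-pos; admissible)
open Digraphs using (extremal-degree-bounds)

proposition3p10 :
    Σ ℚ λ α₀ → 0ℚ < α₀ ×
    (∀ (α : ℚ) → 0ℚ < α → α ≤ α₀ →
      Σ ℚ λ τ₀ → 0ℚ < τ₀ ×
      (∀ (τ : ℚ) → 0ℚ < τ → τ ≤ τ₀ →
        Σ ℚ λ γ₀ → 0ℚ < γ₀ ×
        (∀ (γ : ℚ) → 0ℚ < γ → γ ≤ γ₀ →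
          Σ ℕ λ n₀ →
          ∀ (n : ℕ) → n₀ ℕ.≤ n → ∀ (k d : ℕ) (G : Digraph n) →
          IsRegular G d → α * ℕtoℚ n ≤ ℕtoℚ d →
          ∀ (P : Partition n k) → IsExtremal G τ γ P →
          (∀ (i j : Fin k) (w : Fin n) → P w ≡ (i , j) →
            (∀ (i' : Fin k) → outdegIn G (inCol P i') w ℕ.≤ outdegIn G (inCol P i) w)
            × (∀ (j' : Fin k) → indegIn G (inRow P j') w ℕ.≤ indegIn G (inRow P j) w)
            × (∀ (i' : Fin k) → i' ≢ i → 2 ℕ.* outdegIn G (inCol P i') w ℕ.≤ d)
            × (∀ (j' : Fin k) → j' ≢ j → 2 ℕ.* indegIn G (inRow P j') w ℕ.≤ d))
          × (∀ (v : Fin n) → d ℕ.≤ k ℕ.* goodOut G P v × d ℕ.≤ k ℕ.* goodIn G P v))))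
proposition3p10 =
  1ℚ , 0<1 , λ α 0<α _ →
  ¼ * α , ¼*-pos 0<α , λ τ 0<τ τ≤α/4 →
  ¼ * (α * τ) , ¼*-pos (*-pos 0<α 0<τ) , λ γ _ γ≤ατ/4 →
  4 ℕ.* ↧ₙ α , λ n n≥n₀ k d G → extremal-degree-bounds τ γ G (admissible 0<α 0<τ τ≤α/4 γ≤ατ/4 n≥n₀)
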